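{- Let $T$ be a tree on $n$ vertices and let $p,q$ be positive integers. Then \[ \hom(K_{p,q},T)=\sum_{w\in V(T)}\bigl\{d_T(w)^p+d_T(w)^q\bigr\}-2(n-1). \]
   Context: $\hom(F,G)$ is the number of maps $\phi:V(F)\to V(G)$ sending every edge of $F$ to an edge of $G$. $K_{p,q}$ is the complete bipartite graph with partite sets of sizes $p$ and $q$. $d_T(w)$ is the degree of $w$ in $T$. -}

module Defs where

open import Data.Nat using (ℕ; zero; suc; _+_; _*_; _∸_; _^_; _≤_; _<ᵇ_)
open import Data.Fin using (Fin; toℕ)
open import Data.Bool using (Bool; true; false; _∧_; _∨_; not; _xor_; if_then_else_)
open import Data.List using (List; []; _∷_; _++_; [_]; map; concatMap; length; filter; allFin; foldr)
open import Data.Vec using (Vec; lookup) renaming ([] to []ᵥ; _∷_ to _∷ᵥ_)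
open import Data.List.Relation.Unary.Unique.Propositional using (Unique)
open import Data.List.Relation.Unary.Linked using (Linked)
open import Data.Product using (_×_)
open import Relation.Binary.PropositionalEquality using (_≡_)
open import Relation.Nullary using (¬_)
open import Data.Empty using (⊥)
open import Relation.Binary.PropositionalEquality using (refl)

record Graph (n : ℕ) : Set where
  field
    Adj    : Fin n → Fin n → Bool
    sym    : ∀ u v → Adj u v ≡ Adj v u
    irrefl : ∀ u → Adj u u ≡ false
open Graph public

data Walk {n : ℕ} (G : Graph n) : Fin n → Fin n → Set where
  here : ∀ {u} → Walk G u u
  step : ∀ {u w v} → Adj G u w ≡ true → Walk G w v → Walk G u v

Connected : {n : ℕ} → Graph n → Set
Connected {n} G = (u v : Fin n) → Walk G u v

IsCycle : {n : ℕ} → Graph n → List (Fin n) → Set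
IsCycle G [] = ⊥
IsCycle G (x ∷ xs) =
  (3 ≤ length (x ∷ xs)) × Unique (x ∷ xs) ×
  Linked (λ a b → Adj G a b ≡ true) ((x ∷ xs) ++ [ x ])

Acyclic : {n : ℕ} → Graph n → Set
Acyclic {n} G = (xs : List (Fin n)) → ¬ IsCycle G xs

IsTree : {n : ℕ} → Graph n → Set
IsTree {n} G = (1 ≤ n) × Connected G × Acyclic G

count : {A : Set} → (A → Bool) → List A → ℕ
count P xs = length (filter (λ a → Relation.Nullary.Decidable.Core.T? (P a)) xs)
  where import Relation.Nullary.Decidable.Core

deg : {n : ℕ} → Graph n → Fin n → ℕ
deg {n} G w = count (Adj G w) (allFin n)

allMaps : (m n : ℕ) → List (Vec (Fin n) m)
allMaps zero    n = []ᵥ ∷ []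
allMaps (suc m) n = concatMap (λ v → map (λ i → i ∷ᵥ v) (allFin n)) (allMaps m n)

allL : {A : Set} → (A → Bool) → List A → Bool
allL P = foldr (λ a b → P a ∧ b) true

isHom : {k n : ℕ} → Graph k → Graph n → Vec (Fin n) k → Bool
isHom {k} F G φ =
  allL (λ i → allL (λ j → not (Adj F i j) ∨ Adj G (lookup φ i) (lookup φ j)) (allFin k)) (allFin k)

hom : {k n : ℕ} → Graph k → Graph n → ℕ
hom {k} {n} F G = count (isHom F G) (allMaps k n)

private
  xor-sym : ∀ a b → (a xor b) ≡ (b xor a)
  xor-sym false false = refl
  xor-sym false true  = refl
  xor-sym true  false = refl
  xor-sym true  true  = refl

  xor-self : ∀ a → (a xor a) ≡ false
  xor-self false = refl
  xor-self true  = refl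

-- Complete bipartite graph K_{p,q} on Fin (p + q): parts {i | i < p} and {i | i ≥ p}.
K : (p q : ℕ) → Graph (p + q)
K p q = record
  { Adj    = λ i j → (toℕ i <ᵇ p) xor (toℕ j <ᵇ p)
  ; sym    = λ i j → xor-sym (toℕ i <ᵇ p) (toℕ j <ᵇ p)
  ; irrefl = λ i → xor-self (toℕ i <ᵇ p)
  }

{-# OPTIONS --safe #-}
module Submission where

-- A map K p q → T is a pair (l , r) of maps on the two sides, and it is a
-- homomorphism iff every value of l is a common neighbour of all values of r.
-- Hence hom(K p q, T) = Σ_r codeg(r)^p, where codeg(r) counts the common
-- neighbours of the values of r : [q] → V(T).  In a forest two distinct vertices
-- have at most one common neighbour (two would span a 4-cycle), so codeg(r)^p =
-- codeg(r) unless r is constant at some w, where codeg(r) = d(w).  Therefore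
-- hom(K p q, T) + Σ_w d(w) = Σ_r codeg(r) + Σ_w d(w)^p = Σ_w (d(w)^q + d(w)^p),
-- the last step by double counting.  For a tree Σ_w d(w) = 2(n - 1): grow a
-- subtree from a root, one vertex at a time along a crossing edge; the new vertex
-- has exactly one neighbour in the subtree, since two would close a cycle with
-- the path joining them inside it.

open import Defs hiding (sym)

open import Data.Bool using (Bool; true; false; _∧_; _∨_; not; _xor_)
open import Data.Bool.Properties
  using (∧-conicalˡ; ∧-conicalʳ; ∧-identityʳ; ∧-idem; ∨-identityʳ; ∨-zeroʳ; ¬-not) renaming (_≟_ to _≟ᵇ_)
open import Data.Fin using (Fin; zero; suc; _≟_; toℕ; _↑ˡ_; _↑ʳ_; splitAt)
open import Data.Fin.Properties using (any?; splitAt⁻¹-↑ˡ; splitAt⁻¹-↑ʳ)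
open import Data.List using (List; []; _∷_; _++_; [_]; map; concatMap; allFin; tabulate)
open import Data.List.Properties using (length-++-≤ʳ)
open import Data.List.Relation.Unary.All as All using (All; []; _∷_)
import Data.List.Relation.Unary.All.Properties as All
open import Data.List.Relation.Unary.AllPairs using ([]; _∷_)
import Data.List.Relation.Unary.AllPairs.Properties as AllPairs
open import Data.List.Relation.Unary.Linked using (Linked; []; [-]; _∷_)
open import Data.List.Relation.Unary.Unique.Propositional using (Unique)
open import Data.Nat using (ℕ; zero; suc; _+_; _*_; _∸_; _^_; _≤_; _<_; z≤n; s≤s; _<ᵇ_)
open import Data.Nat using () renaming (_+_ to _+ℕ_; _*_ to _*ℕ_)
open import Data.Nat.ListAction using (sum)
open import Data.Nat.Properties
  using ( +-*-semiring; +-commutativeSemigroup; +-identityʳ; +-assoc; +-comm; *-identityˡ; *-zeroʳ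
        ; *-distribˡ-+; *-distribʳ-+; ^-zeroˡ; ≤-refl; ≤-reflexive; ≤-trans; +-mono-≤; <⇒≤; <⇒≢; 1+n≰n
        ; suc-injective; m≤n+m; m+n∸n≡m )
open import Data.Product using (_×_; _,_; ∃)
open import Data.Sum using (_⊎_; inj₁; inj₂)
open import Data.Vec using (Vec; lookup; head) renaming ([] to []ᵥ; _∷_ to _∷ᵥ_; _++_ to _++ᵥ_)
open import Data.Vec.Properties using (lookup-++ˡ; lookup-++ʳ)
open import Function using (_∘_; id)
open import Function.Bundles using (_⇔_; mk⇔; Equivalence)
open import Relation.Binary.PropositionalEquality hiding ([_])
open import Relation.Nullary using (yes; no; does; contradiction)
open import Relation.Nullary.Decidable using (dec-true)

open import Algebra.Properties.CommutativeSemigroup +-commutativeSemigroup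
  using () renaming (interchange to +-interchange)
open import Algebra.Properties.Semiring.Sum +-*-semiring
  using (sum-syntax; ∑-distrib-+; *-distribʳ-sum; sum-cong-≗; sum-replicate-zero)

-- Indicators and finite sums

𝟙 : Bool → ℕ
𝟙 true  = 1
𝟙 false = 0

𝟙-∧ : ∀ a b → 𝟙 (a ∧ b) ≡ 𝟙 a * 𝟙 b
𝟙-∧ true  b = sym (+-identityʳ (𝟙 b))
𝟙-∧ false b = refl

bool-ext : ∀ {a b : Bool} → (a ≡ true → b ≡ true) → (b ≡ true → a ≡ true) → a ≡ b
bool-ext {false} {false} _ _ = refl
bool-ext {false} {true}  _ g = g refl
bool-ext {true}  {false} f _ = sym (f refl)
bool-ext {true}  {true}  _ _ = refl

≟-true⇒≡ : ∀ {n} {a b : Fin n} → does (a ≟ b) ≡ true → a ≡ b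
≟-true⇒≡ {a = a} {b} eq with a ≟ b
... | yes a≡b = a≡b

≟-false⇒≢ : ∀ {n} {a b : Fin n} → does (a ≟ b) ≡ false → a ≢ b
≟-false⇒≢ {a = a} h refl = contradiction (trans (sym (dec-true (a ≟ a) refl)) h) λ ()

∑∈ : {A : Set} → List A → (A → ℕ) → ℕ
∑∈ xs f = sum (map f xs)

-- Same precedence as the library's ∑[ i < n ]: a body containing an infix operator needs parentheses.
infixl 10 ∑∈
syntax ∑∈ xs (λ x → e) = ∑[ x ∈ xs ] e

module _ {A : Set} where

  ∑∈-cong : ∀ (xs : List A) {f g : A → ℕ} → (∀ a → f a ≡ g a) → ∑[ a ∈ xs ] f a ≡ ∑[ a ∈ xs ] g a
  ∑∈-cong []       _  = refl
  ∑∈-cong (x ∷ xs) eq = cong₂ _+_ (eq x) (∑∈-cong xs eq)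

  ∑∈-++ : ∀ (xs ys : List A) (f : A → ℕ) → ∑[ a ∈ xs ++ ys ] f a ≡ ∑[ a ∈ xs ] f a + ∑[ a ∈ ys ] f a
  ∑∈-++ []       ys f = refl
  ∑∈-++ (x ∷ xs) ys f = trans (cong (f x +_) (∑∈-++ xs ys f)) (sym (+-assoc (f x) _ _))

  ∑∈-map : ∀ {B : Set} (h : A → B) (xs : List A) (f : B → ℕ) → ∑[ b ∈ map h xs ] f b ≡ ∑[ a ∈ xs ] f (h a)
  ∑∈-map h []       f = refl
  ∑∈-map h (x ∷ xs) f = cong (f (h x) +_) (∑∈-map h xs f)

  ∑∈-tabulate : ∀ {n} (h : Fin n → A) (f : A → ℕ) → ∑[ a ∈ tabulate h ] f a ≡ ∑[ i < n ] f (h i)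
  ∑∈-tabulate {zero}  h f = refl
  ∑∈-tabulate {suc n} h f = cong (f (h zero) +_) (∑∈-tabulate (h ∘ suc) f)

  *-distribʳ-∑∈ : ∀ (xs : List A) (f : A → ℕ) k → (∑[ a ∈ xs ] f a) * k ≡ ∑[ a ∈ xs ] (f a * k)
  *-distribʳ-∑∈ []       f k = refl
  *-distribʳ-∑∈ (x ∷ xs) f k = trans (*-distribʳ-+ k (f x) _) (cong (f x * k +_) (*-distribʳ-∑∈ xs f k))

  *-distribˡ-∑∈ : ∀ (xs : List A) k (f : A → ℕ) → k * (∑[ a ∈ xs ] f a) ≡ ∑[ a ∈ xs ] (k * f a)
  *-distribˡ-∑∈ []       k f = *-zeroʳ k
  *-distribˡ-∑∈ (x ∷ xs) k f = trans (*-distribˡ-+ k (f x) _) (cong (k * f x +_) (*-distribˡ-∑∈ xs k f))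

  ∑∈-distrib-+ : ∀ (xs : List A) (f g : A → ℕ) → ∑[ a ∈ xs ] (f a + g a) ≡ ∑[ a ∈ xs ] f a + ∑[ a ∈ xs ] g a
  ∑∈-distrib-+ []       f g = refl
  ∑∈-distrib-+ (x ∷ xs) f g =
    trans (cong (f x + g x +_) (∑∈-distrib-+ xs f g)) (+-interchange (f x) (g x) _ _)

  ∑∈-comm : ∀ (xs : List A) n (f : A → Fin n → ℕ) → ∑[ a ∈ xs ] ∑[ i < n ] f a i ≡ ∑[ i < n ] ∑[ a ∈ xs ] f a i
  ∑∈-comm []       n f = sym (sum-replicate-zero n)
  ∑∈-comm (x ∷ xs) n f = trans (cong (∑[ i < n ] f x i +_) (∑∈-comm xs n f)) (sym (∑-distrib-+ (f x) _))

∑∈-concatMap : ∀ {A B : Set} (h : A → List B) (xs : List A) (f : B → ℕ) →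
               ∑[ b ∈ concatMap h xs ] f b ≡ ∑[ a ∈ xs ] ∑[ b ∈ h a ] f b
∑∈-concatMap h []       f = refl
∑∈-concatMap h (x ∷ xs) f = trans (∑∈-++ (h x) (concatMap h xs) f) (cong (∑[ b ∈ h x ] f b +_) (∑∈-concatMap h xs f))

count≡∑𝟙 : ∀ {A : Set} (P : A → Bool) xs → count P xs ≡ ∑[ a ∈ xs ] 𝟙 (P a)
count≡∑𝟙 P []       = refl
count≡∑𝟙 P (x ∷ xs) with P x
... | true  = cong suc (count≡∑𝟙 P xs)
... | false = count≡∑𝟙 P xs

∑∈-allFin : ∀ n (f : Fin n → ℕ) → ∑[ i ∈ allFin n ] f i ≡ ∑[ i < n ] f i
∑∈-allFin n f = ∑∈-tabulate id f

count-allFin : ∀ {n} (P : Fin n → Bool) → count P (allFin n) ≡ ∑[ i < n ] 𝟙 (P i)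
count-allFin {n} P = trans (count≡∑𝟙 P (allFin n)) (∑∈-allFin n (𝟙 ∘ P))

∑-𝟙≟-* : ∀ {n} (x : Fin n) (f : Fin n → ℕ) → ∑[ z < n ] (𝟙 (does (z ≟ x)) * f z) ≡ f x
∑-𝟙≟-* {suc n} zero    f = trans (cong₂ _+_ (+-identityʳ (f zero)) (sum-replicate-zero n)) (+-identityʳ (f zero))
∑-𝟙≟-* {suc n} (suc x) f = ∑-𝟙≟-* x (f ∘ suc)

∑-𝟙-unique : ∀ {n} (P : Fin n → Bool) {s} → P s ≡ true → (∀ z → P z ≡ true → z ≡ s) →
             ∑[ z < n ] 𝟙 (P z) ≡ 1
∑-𝟙-unique {n} P {s} Ps unique = trans (sum-cong-≗ P≐δ) (∑-𝟙≟-* s (λ _ → 1))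
  where
  P≐δ : ∀ z → 𝟙 (P z) ≡ 𝟙 (does (z ≟ s)) * 1
  P≐δ z with z ≟ s
  ... | yes refl = cong 𝟙 Ps
  ... | no  z≢s  = cong 𝟙 (¬-not (z≢s ∘ unique z))

∑-𝟙≟ : ∀ {n} (x : Fin n) → ∑[ z < n ] 𝟙 (does (z ≟ x)) ≡ 1
∑-𝟙≟ x = ∑-𝟙-unique (λ z → does (z ≟ x)) (dec-true (x ≟ x) refl) (λ z → ≟-true⇒≡)

count-≟ : ∀ {n} (x : Fin n) → count (λ z → does (z ≟ x)) (allFin n) ≡ 1
count-≟ x = trans (count-allFin (λ z → does (z ≟ x))) (∑-𝟙≟ x)

∑-𝟙≤1 : ∀ {n} (P : Fin n → Bool) → (∀ y z → P y ≡ true → P z ≡ true → y ≡ z) →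
                ∑[ z < n ] 𝟙 (P z) ≤ 1
∑-𝟙≤1 {n} P unique with any? (λ z → P z ≟ᵇ true)
... | yes (s , Ps) = ≤-reflexive (∑-𝟙-unique P Ps (λ z Pz → unique z s Pz Ps))
... | no  none     = ≤-trans (≤-reflexive (trans (sum-cong-≗ P≐0) (sum-replicate-zero n))) z≤n
  where
  P≐0 : ∀ z → 𝟙 (P z) ≡ 0
  P≐0 z = cong 𝟙 (¬-not (none ∘ (z ,_)))

∑-𝟙-all : ∀ {n} (P : Fin n → Bool) → (∀ z → P z ≡ true) → ∑[ z < n ] 𝟙 (P z) ≡ n
∑-𝟙-all {zero}  P all = refl
∑-𝟙-all {suc n} P all = cong₂ _+_ (cong 𝟙 (all zero)) (∑-𝟙-all (P ∘ suc) (all ∘ suc))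

∑-𝟙≤n : ∀ {n} (P : Fin n → Bool) → ∑[ z < n ] 𝟙 (P z) ≤ n
∑-𝟙≤n {zero}  P = z≤n
∑-𝟙≤n {suc n} P = +-mono-≤ (𝟙≤1 (P zero)) (∑-𝟙≤n (P ∘ suc))
  where
  𝟙≤1 : ∀ b → 𝟙 b ≤ 1
  𝟙≤1 true  = s≤s z≤n
  𝟙≤1 false = z≤n

-- Sums over all maps Fin m → Fin n

allᵛ : ∀ {A : Set} {m} → (A → Bool) → Vec A m → Bool
allᵛ P []ᵥ      = true
allᵛ P (x ∷ᵥ v) = P x ∧ allᵛ P v

allᵛ⁺ : ∀ {A : Set} {m} (P : A → Bool) (v : Vec A m) → (∀ i → P (lookup v i) ≡ true) → allᵛ P v ≡ true
allᵛ⁺ P []ᵥ      h = refl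
allᵛ⁺ P (x ∷ᵥ v) h = cong₂ _∧_ (h zero) (allᵛ⁺ P v (h ∘ suc))

allᵛ⁻ : ∀ {A : Set} {m} (P : A → Bool) (v : Vec A m) → allᵛ P v ≡ true → ∀ i → P (lookup v i) ≡ true
allᵛ⁻ P (x ∷ᵥ v) h zero    = ∧-conicalˡ _ _ h
allᵛ⁻ P (x ∷ᵥ v) h (suc i) = allᵛ⁻ P v (∧-conicalʳ _ _ h) i

allᵛ-false : ∀ {A : Set} {m} (P : A → Bool) (v : Vec A m) → allᵛ P v ≡ false → ∃ λ i → P (lookup v i) ≡ false
allᵛ-false P (x ∷ᵥ v) h with P x in Px
... | false = zero , Px
... | true  with allᵛ-false P v h
...   | i , Pvi = suc i , Pvi

allᵛ-≟-∧ : ∀ {n m} {x : Fin n} (v : Vec (Fin n) m) → allᵛ (λ z → does (z ≟ x)) v ≡ true →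
           ∀ P → P x ∧ allᵛ P v ≡ P x
allᵛ-≟-∧ []ᵥ h P = ∧-identityʳ _
allᵛ-≟-∧ {x = x} (z ∷ᵥ v) h P with z ≟ x
... | yes refl = trans (cong (P z ∧_) (allᵛ-≟-∧ v h P)) (∧-idem (P z))

∑-allMaps-suc : ∀ m n (f : Vec (Fin n) (suc m) → ℕ) →
                ∑[ φ ∈ allMaps (suc m) n ] f φ ≡ ∑[ v ∈ allMaps m n ] ∑[ i < n ] f (i ∷ᵥ v)
∑-allMaps-suc m n f = trans (∑∈-concatMap _ (allMaps m n) f) (∑∈-cong (allMaps m n) ∑-column)
  where
  ∑-column : ∀ v → ∑[ φ ∈ map (_∷ᵥ v) (allFin n) ] f φ ≡ ∑[ i < n ] f (i ∷ᵥ v)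
  ∑-column v = trans (∑∈-map (_∷ᵥ v) (allFin n) f) (∑∈-allFin n (λ i → f (i ∷ᵥ v)))

∑-allMaps-++ : ∀ p q n (f : Vec (Fin n) (p + q) → ℕ) →
               ∑[ φ ∈ allMaps (p + q) n ] f φ ≡ ∑[ r ∈ allMaps q n ] ∑[ l ∈ allMaps p n ] f (l ++ᵥ r)
∑-allMaps-++ zero    q n f = ∑∈-cong (allMaps q n) (λ r → sym (+-identityʳ (f r)))
∑-allMaps-++ (suc p) q n f = begin
  ∑[ φ ∈ allMaps (suc p + q) n ] f φ                                      ≡⟨ ∑-allMaps-suc (p + q) n f ⟩
  ∑[ v ∈ allMaps (p + q) n ] ∑[ i < n ] f (i ∷ᵥ v)                        ≡⟨ ∑-allMaps-++ p q n _ ⟩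
  ∑[ r ∈ allMaps q n ] ∑[ l ∈ allMaps p n ] ∑[ i < n ] f (i ∷ᵥ l ++ᵥ r)   ≡⟨ ∑∈-cong (allMaps q n) (λ r → sym (∑-allMaps-suc p n _)) ⟩
  ∑[ r ∈ allMaps q n ] ∑[ l ∈ allMaps (suc p) n ] f (l ++ᵥ r)             ∎
  where open ≡-Reasoning

∑-allMaps-allᵛ : ∀ m n (P : Fin n → Bool) → ∑[ v ∈ allMaps m n ] 𝟙 (allᵛ P v) ≡ count P (allFin n) ^ m
∑-allMaps-allᵛ zero    n P = refl
∑-allMaps-allᵛ (suc m) n P = begin
  ∑[ v ∈ allMaps (suc m) n ] 𝟙 (allᵛ P v)                                   ≡⟨ ∑-allMaps-suc m n _ ⟩
  ∑[ v ∈ allMaps m n ] ∑[ i < n ] 𝟙 (P i ∧ allᵛ P v)                        ≡⟨ ∑∈-cong (allMaps m n) factor ⟩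
  ∑[ v ∈ allMaps m n ] (count P (allFin n) * 𝟙 (allᵛ P v))                  ≡⟨ *-distribˡ-∑∈ (allMaps m n) (count P (allFin n)) (𝟙 ∘ allᵛ P) ⟨
  count P (allFin n) * ∑[ v ∈ allMaps m n ] 𝟙 (allᵛ P v)                    ≡⟨ cong (count P (allFin n) *_) (∑-allMaps-allᵛ m n P) ⟩
  count P (allFin n) * count P (allFin n) ^ m                               ∎
  where
  open ≡-Reasoning
  factor : ∀ v → ∑[ i < n ] 𝟙 (P i ∧ allᵛ P v) ≡ count P (allFin n) * 𝟙 (allᵛ P v)
  factor v = begin
    ∑[ i < n ] 𝟙 (P i ∧ allᵛ P v)            ≡⟨ sum-cong-≗ (λ i → 𝟙-∧ (P i) (allᵛ P v)) ⟩
    ∑[ i < n ] (𝟙 (P i) * 𝟙 (allᵛ P v))      ≡⟨ *-distribʳ-sum (𝟙 (allᵛ P v)) (𝟙 ∘ P) ⟨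
    (∑[ i < n ] 𝟙 (P i)) * 𝟙 (allᵛ P v)      ≡⟨ cong (_* 𝟙 (allᵛ P v)) (count-allFin P) ⟨
    count P (allFin n) * 𝟙 (allᵛ P v)        ∎

isConstant : ∀ {n m} → Vec (Fin n) (suc m) → Bool
isConstant (x ∷ᵥ v) = allᵛ (λ z → does (z ≟ x)) v

∑-allMaps-isConstant : ∀ m n (f : Fin n → ℕ) →
                       ∑[ r ∈ allMaps (suc m) n ] (𝟙 (isConstant r) * f (head r)) ≡ ∑[ x < n ] f x
∑-allMaps-isConstant m n f = begin
  ∑[ r ∈ allMaps (suc m) n ] (𝟙 (isConstant r) * f (head r))                ≡⟨ ∑-allMaps-suc m n _ ⟩
  ∑[ v ∈ allMaps m n ] ∑[ x < n ] (𝟙 (allᵛ (λ z → does (z ≟ x)) v) * f x)   ≡⟨ ∑∈-comm (allMaps m n) n _ ⟩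
  ∑[ x < n ] ∑[ v ∈ allMaps m n ] (𝟙 (allᵛ (λ z → does (z ≟ x)) v) * f x)   ≡⟨ sum-cong-≗ column ⟩
  ∑[ x < n ] f x                                                            ∎
  where
  open ≡-Reasoning
  column : ∀ x → ∑[ v ∈ allMaps m n ] (𝟙 (allᵛ (λ z → does (z ≟ x)) v) * f x) ≡ f x
  column x = begin
    ∑[ v ∈ allMaps m n ] (𝟙 (allᵛ (λ z → does (z ≟ x)) v) * f x)   ≡⟨ *-distribʳ-∑∈ (allMaps m n) _ (f x) ⟨
    (∑[ v ∈ allMaps m n ] 𝟙 (allᵛ (λ z → does (z ≟ x)) v)) * f x   ≡⟨ cong (_* f x) (∑-allMaps-allᵛ m n _) ⟩
    count (λ z → does (z ≟ x)) (allFin n) ^ m * f x                ≡⟨ cong (λ c → c ^ m * f x) (count-≟ x) ⟩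
    1 ^ m * f x                                                    ≡⟨ cong (_* f x) (^-zeroˡ m) ⟩
    1 * f x                                                        ≡⟨ *-identityˡ (f x) ⟩
    f x                                                            ∎

-- Homomorphisms from K p q

Edge : ∀ {n} → Graph n → Fin n → Fin n → Set
Edge G u v = Adj G u v ≡ true

Edge-sym : ∀ {n} (G : Graph n) {u v} → Edge G u v → Edge G v u
Edge-sym G {u} {v} e = trans (Graph.sym G v u) e

Edge⇒≢ : ∀ {n} (G : Graph n) {u v} → Edge G u v → u ≢ v
Edge⇒≢ G {u} e refl = contradiction (trans (sym e) (irrefl G u)) λ ()

IsHom : ∀ {k n} → Graph k → Graph n → Vec (Fin n) k → Set
IsHom F G φ = ∀ i j → Edge F i j → Edge G (lookup φ i) (lookup φ j)

allL⁺ : ∀ {A : Set} (P : A → Bool) {xs} → All (λ a → P a ≡ true) xs → allL P xs ≡ true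
allL⁺ P []         = refl
allL⁺ P (Px ∷ Pxs) = cong₂ _∧_ Px (allL⁺ P Pxs)

allL⁻ : ∀ {A : Set} (P : A → Bool) xs → allL P xs ≡ true → All (λ a → P a ≡ true) xs
allL⁻ P []       h = []
allL⁻ P (x ∷ xs) h = ∧-conicalˡ _ _ h ∷ allL⁻ P xs (∧-conicalʳ _ _ h)

isHom⇒IsHom : ∀ {k n} (F : Graph k) (G : Graph n) φ → isHom F G φ ≡ true → IsHom F G φ
isHom⇒IsHom {k} F G φ h i j Fij = implies (All.tabulate⁻ (allL⁻ _ _ (All.tabulate⁻ (allL⁻ _ (allFin k) h) i)) j) Fij
  where
  implies : ∀ {a b} → not a ∨ b ≡ true → a ≡ true → b ≡ true
  implies {true} b≡true refl = b≡true

IsHom⇒isHom : ∀ {k n} (F : Graph k) (G : Graph n) φ → IsHom F G φ → isHom F G φ ≡ true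
IsHom⇒isHom F G φ h = allL⁺ _ (All.tabulate⁺ (λ i → allL⁺ _ (All.tabulate⁺ (λ j → implied (h i j)))))
  where
  implied : ∀ {a b} → (a ≡ true → b ≡ true) → not a ∨ b ≡ true
  implied {false} _ = refl
  implied {true}  f = f refl

data Side (p q : ℕ) : Fin (p + q) → Set where
  left  : (a : Fin p) → Side p q (a ↑ˡ q)
  right : (b : Fin q) → Side p q (p ↑ʳ b)

side : ∀ p q i → Side p q i
side p q i with splitAt p i in eq
... | inj₁ a = subst (Side p q) (splitAt⁻¹-↑ˡ eq) (left a)
... | inj₂ b = subst (Side p q) (splitAt⁻¹-↑ʳ eq) (right b)

<ᵇ-↑ˡ : ∀ {p} (a : Fin p) q → (toℕ (a ↑ˡ q) <ᵇ p) ≡ true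
<ᵇ-↑ˡ zero    q = refl
<ᵇ-↑ˡ (suc a) q = <ᵇ-↑ˡ a q

<ᵇ-↑ʳ : ∀ p {q} (b : Fin q) → (toℕ (p ↑ʳ b) <ᵇ p) ≡ false
<ᵇ-↑ʳ zero    b = refl
<ᵇ-↑ʳ (suc p) b = <ᵇ-↑ʳ p b

module _ (p q : ℕ) where

  K-adj-ll : ∀ a a' → Adj (K p q) (a ↑ˡ q) (a' ↑ˡ q) ≡ false
  K-adj-ll a a' = cong₂ _xor_ (<ᵇ-↑ˡ a q) (<ᵇ-↑ˡ a' q)

  K-adj-lr : ∀ a b → Adj (K p q) (a ↑ˡ q) (p ↑ʳ b) ≡ true
  K-adj-lr a b = cong₂ _xor_ (<ᵇ-↑ˡ a q) (<ᵇ-↑ʳ p b)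

  K-adj-rr : ∀ b b' → Adj (K p q) (p ↑ʳ b) (p ↑ʳ b') ≡ false
  K-adj-rr b b' = cong₂ _xor_ (<ᵇ-↑ʳ p b) (<ᵇ-↑ʳ p b')

module _ {n} (T : Graph n) where

  IsHom-K⇔ : ∀ {p q} (l : Vec (Fin n) p) (r : Vec (Fin n) q) →
             IsHom (K p q) T (l ++ᵥ r) ⇔ (∀ a b → Edge T (lookup l a) (lookup r b))
  IsHom-K⇔ {p} {q} l r = mk⇔ to from
    where
    to : IsHom (K p q) T (l ++ᵥ r) → ∀ a b → Edge T (lookup l a) (lookup r b)
    to h a b = subst₂ (Edge T) (lookup-++ˡ l r a) (lookup-++ʳ l r b) (h (a ↑ˡ q) (p ↑ʳ b) (K-adj-lr p q a b))

    from : (∀ a b → Edge T (lookup l a) (lookup r b)) → IsHom (K p q) T (l ++ᵥ r)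
    from h i j Kij with side p q i | side p q j
    ... | left a  | left a'  = contradiction (trans (sym Kij) (K-adj-ll p q a a')) λ ()
    ... | left a  | right b  = subst₂ (Edge T) (sym (lookup-++ˡ l r a)) (sym (lookup-++ʳ l r b)) (h a b)
    ... | right b | left a   = subst₂ (Edge T) (sym (lookup-++ʳ l r b)) (sym (lookup-++ˡ l r a))
                                 (Edge-sym T (h a b))
    ... | right b | right b' = contradiction (trans (sym Kij) (K-adj-rr p q b b')) λ ()

  isHom-K-++ : ∀ {p q} (l : Vec (Fin n) p) (r : Vec (Fin n) q) →
               isHom (K p q) T (l ++ᵥ r) ≡ allᵛ (λ y → allᵛ (Adj T y) r) l
  isHom-K-++ {p} {q} l r = bool-ext
    (λ h → allᵛ⁺ _ l (λ a → allᵛ⁺ _ r (Equivalence.to (IsHom-K⇔ l r) (isHom⇒IsHom (K p q) T (l ++ᵥ r) h) a)))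
    (λ h → IsHom⇒isHom (K p q) T (l ++ᵥ r) (Equivalence.from (IsHom-K⇔ l r) (λ a → allᵛ⁻ _ r (allᵛ⁻ _ l h a))))

  codeg : ∀ {q} → Vec (Fin n) q → ℕ
  codeg r = count (λ y → allᵛ (Adj T y) r) (allFin n)

  hom-K≡∑codeg^ : ∀ p q → hom (K p q) T ≡ ∑[ r ∈ allMaps q n ] (codeg r ^ p)
  hom-K≡∑codeg^ p q = begin
    hom (K p q) T                                                           ≡⟨ count≡∑𝟙 _ (allMaps (p + q) n) ⟩
    ∑[ φ ∈ allMaps (p + q) n ] 𝟙 (isHom (K p q) T φ)                        ≡⟨ ∑-allMaps-++ p q n _ ⟩
    ∑[ r ∈ allMaps q n ] ∑[ l ∈ allMaps p n ] 𝟙 (isHom (K p q) T (l ++ᵥ r)) ≡⟨ ∑∈-cong (allMaps q n) ∑-commonNeighbourMaps ⟩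
    ∑[ r ∈ allMaps q n ] (codeg r ^ p)                                        ∎
    where
    open ≡-Reasoning
    ∑-commonNeighbourMaps : ∀ r → ∑[ l ∈ allMaps p n ] 𝟙 (isHom (K p q) T (l ++ᵥ r)) ≡ codeg r ^ p
    ∑-commonNeighbourMaps r = trans (∑∈-cong (allMaps p n) (λ l → cong 𝟙 (isHom-K-++ l r))) (∑-allMaps-allᵛ p n _)

  ∑-codeg : ∀ q → ∑[ r ∈ allMaps q n ] codeg r ≡ ∑[ y < n ] (deg T y ^ q)
  ∑-codeg q = begin
    ∑[ r ∈ allMaps q n ] codeg r                              ≡⟨ ∑∈-cong (allMaps q n) (λ r → count-allFin (λ y → allᵛ (Adj T y) r)) ⟩
    ∑[ r ∈ allMaps q n ] ∑[ y < n ] 𝟙 (allᵛ (Adj T y) r)      ≡⟨ ∑∈-comm (allMaps q n) n _ ⟩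
    ∑[ y < n ] ∑[ r ∈ allMaps q n ] 𝟙 (allᵛ (Adj T y) r)      ≡⟨ sum-cong-≗ (λ y → ∑-allMaps-allᵛ q n (Adj T y)) ⟩
    ∑[ y < n ] (deg T y ^ q)                                    ∎
    where open ≡-Reasoning

-- Forests

m≤1⇒m^[1+n]≡m : ∀ {m} n → m ≤ 1 → m ^ suc n ≡ m
m≤1⇒m^[1+n]≡m {zero}  n _       = refl
m≤1⇒m^[1+n]≡m {suc _} n (s≤s z≤n) = trans (+-identityʳ _) (^-zeroˡ n)

module Forest {n} (T : Graph n) (acyclic : Acyclic T) where

  commonNeighbour-unique : ∀ {x z y y'} → x ≢ z →
                           Edge T y x → Edge T y z → Edge T y' x → Edge T y' z → y ≡ y'
  commonNeighbour-unique {x} {z} {y} {y'} x≢z yx yz y'x y'z with y ≟ y'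
  ... | yes y≡y' = y≡y'
  ... | no  y≢y' = contradiction (s≤s (s≤s (s≤s z≤n)) , distinct , closed) (acyclic (y ∷ x ∷ y' ∷ z ∷ []))
    where
    distinct : Unique (y ∷ x ∷ y' ∷ z ∷ [])
    distinct = (Edge⇒≢ T yx ∷ y≢y' ∷ Edge⇒≢ T yz ∷ [])
             ∷ (Edge⇒≢ T (Edge-sym T y'x) ∷ x≢z ∷ [])
             ∷ (Edge⇒≢ T y'z ∷ [])
             ∷ [] ∷ []
    closed : Linked (Edge T) (y ∷ x ∷ y' ∷ z ∷ y ∷ [])
    closed = yx ∷ Edge-sym T y'x ∷ y'z ∷ Edge-sym T yz ∷ [-]

  codeg-constant : ∀ {m} x (v : Vec (Fin n) m) → allᵛ (λ z → does (z ≟ x)) v ≡ true →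
                   codeg T (x ∷ᵥ v) ≡ deg T x
  codeg-constant x v h = begin
    codeg T (x ∷ᵥ v)                               ≡⟨ count-allFin (λ y → allᵛ (Adj T y) (x ∷ᵥ v)) ⟩
    ∑[ y < n ] 𝟙 (Adj T y x ∧ allᵛ (Adj T y) v)    ≡⟨ sum-cong-≗ (λ y → cong 𝟙 (trans (allᵛ-≟-∧ v h (Adj T y)) (Graph.sym T y x))) ⟩
    ∑[ y < n ] 𝟙 (Adj T x y)                       ≡⟨ count-allFin (Adj T x) ⟨
    deg T x                                        ∎
    where open ≡-Reasoning

  codeg-nonconstant : ∀ {m} x (v : Vec (Fin n) m) → allᵛ (λ z → does (z ≟ x)) v ≡ false →
                      codeg T (x ∷ᵥ v) ≤ 1
  codeg-nonconstant x v h with allᵛ-false _ v h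
  ... | i , vᵢ≢x = subst (_≤ 1) (sym (count-allFin common)) (∑-𝟙≤1 common unique)
    where
    common : Fin n → Bool
    common y = allᵛ (Adj T y) (x ∷ᵥ v)
    unique : ∀ y y' → common y ≡ true → common y' ≡ true → y ≡ y'
    unique y y' cy cy' = commonNeighbour-unique (≟-false⇒≢ vᵢ≢x ∘ sym)
      (∧-conicalˡ _ _ cy)  (allᵛ⁻ _ v (∧-conicalʳ _ _ cy) i)
      (∧-conicalˡ _ _ cy') (allᵛ⁻ _ v (∧-conicalʳ _ _ cy') i)

  codeg^-exchange : ∀ p {m} (r : Vec (Fin n) (suc m)) →
                 codeg T r ^ suc p + 𝟙 (isConstant r) * deg T (head r) ≡
                 codeg T r + 𝟙 (isConstant r) * deg T (head r) ^ suc p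
  codeg^-exchange p (x ∷ᵥ v) with allᵛ (λ z → does (z ≟ x)) v in h
  ... | true  rewrite codeg-constant x v h =
    trans (+-comm (deg T x ^ suc p) _) (cong₂ _+_ (+-identityʳ (deg T x)) (sym (+-identityʳ _)))
  ... | false = cong (_+ 0) (m≤1⇒m^[1+n]≡m p (codeg-nonconstant x v h))

  hom-K+∑deg : ∀ p q → hom (K (suc p) (suc q)) T + ∑[ w < n ] deg T w ≡ ∑[ w < n ] (deg T w ^ suc p + deg T w ^ suc q)
  hom-K+∑deg p q = begin
    hom (K (suc p) (suc q)) T + ∑[ w < n ] deg T w
      ≡⟨ cong₂ _+_ (hom-K≡∑codeg^ T (suc p) (suc q)) (sym (∑-allMaps-isConstant q n (deg T))) ⟩
    ∑[ r ∈ R ] (codeg T r ^ suc p) + ∑[ r ∈ R ] (𝟙 (isConstant r) * deg T (head r))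
      ≡⟨ ∑∈-distrib-+ R _ _ ⟨
    ∑[ r ∈ R ] (codeg T r ^ suc p + 𝟙 (isConstant r) * deg T (head r))
      ≡⟨ ∑∈-cong R (codeg^-exchange p) ⟩
    ∑[ r ∈ R ] (codeg T r + 𝟙 (isConstant r) * deg T (head r) ^ suc p)
      ≡⟨ ∑∈-distrib-+ R _ _ ⟩
    ∑[ r ∈ R ] codeg T r + ∑[ r ∈ R ] (𝟙 (isConstant r) * deg T (head r) ^ suc p)
      ≡⟨ cong₂ _+_ (∑-codeg T (suc q)) (∑-allMaps-isConstant q n (λ w → deg T w ^ suc p)) ⟩
    ∑[ w < n ] (deg T w ^ suc q) + ∑[ w < n ] (deg T w ^ suc p)
      ≡⟨ +-comm (∑[ w < n ] (deg T w ^ suc q)) _ ⟩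
    ∑[ w < n ] (deg T w ^ suc p) + ∑[ w < n ] (deg T w ^ suc q)
      ≡⟨ ∑-distrib-+ (λ w → deg T w ^ suc p) (λ w → deg T w ^ suc q) ⟨
    ∑[ w < n ] (deg T w ^ suc p + deg T w ^ suc q) ∎
    where
    open ≡-Reasoning
    R : List (Vec (Fin n) (suc q))
    R = allMaps (suc q) n

-- Trees: the degree sum

insert : ∀ {n} → Fin n → (Fin n → Bool) → Fin n → Bool
insert x S z = S z ∨ does (z ≟ x)

module _ {n} (S : Fin n → Bool) (x : Fin n) where

  insert-⊇ : ∀ {z} → S z ≡ true → insert x S z ≡ true
  insert-⊇ {z} Sz = cong (_∨ does (z ≟ x)) Sz

  insert-∋ : insert x S x ≡ true
  insert-∋ = trans (cong (S x ∨_) (dec-true (x ≟ x) refl)) (∨-zeroʳ (S x))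

  insert⁻ : ∀ {z} → insert x S z ≡ true → S z ≡ true ⊎ z ≡ x
  insert⁻ {z} h with S z | z ≟ x
  ... | true  | _        = inj₁ refl
  ... | false | yes z≡x  = inj₂ z≡x

  𝟙-insert : S x ≡ false → ∀ z → 𝟙 (insert x S z) ≡ 𝟙 (S z) + 𝟙 (does (z ≟ x))
  𝟙-insert Sx z with z ≟ x
  ... | yes refl rewrite Sx = refl
  ... | no  _    = trans (cong 𝟙 (∨-identityʳ (S z))) (sym (+-identityʳ _))

  ∑-𝟙-insert : S x ≡ false → ∑[ z < n ] 𝟙 (insert x S z) ≡ suc (∑[ z < n ] 𝟙 (S z))
  ∑-𝟙-insert Sx = begin
    ∑[ z < n ] 𝟙 (insert x S z)                                ≡⟨ sum-cong-≗ (𝟙-insert Sx) ⟩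
    ∑[ z < n ] (𝟙 (S z) + 𝟙 (does (z ≟ x)))                    ≡⟨ ∑-distrib-+ (𝟙 ∘ S) _ ⟩
    ∑[ z < n ] 𝟙 (S z) + ∑[ z < n ] 𝟙 (does (z ≟ x))          ≡⟨ cong (∑[ z < n ] 𝟙 (S z) +_) (∑-𝟙≟ x) ⟩
    ∑[ z < n ] 𝟙 (S z) + 1                                     ≡⟨ +-comm _ 1 ⟩
    suc (∑[ z < n ] 𝟙 (S z))                                   ∎
    where open ≡-Reasoning

Linked-snoc : ∀ {A : Set} {R : A → A → Set} a mid {b c} →
              Linked R (a ∷ mid ++ [ b ]) → R b c → Linked R (a ∷ (mid ++ [ b ]) ++ [ c ])
Linked-snoc a []        (ab ∷ [-])   bc = ab ∷ bc ∷ [-]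
Linked-snoc a (y ∷ mid) (ay ∷ rest) bc = ay ∷ Linked-snoc y mid rest bc

module _ {n} (T : Graph n) where

  pathVertices : Fin n → List (Fin n) → Fin n → List (Fin n)
  pathVertices a mid b = a ∷ mid ++ [ b ]

  record SimplePath (S : Fin n → Bool) (a b : Fin n) : Set where
    field
      interior : List (Fin n)
      unique   : Unique (pathVertices a interior b)
      inside   : All (λ z → S z ≡ true) (pathVertices a interior b)
      linked   : Linked (Edge T) (pathVertices a interior b)

  ConnectedIn : (Fin n → Bool) → Set
  ConnectedIn S = ∀ {a b} → S a ≡ true → S b ≡ true → a ≢ b → SimplePath S a b

  SimplePath-mono : ∀ {S S' a b} → (∀ {z} → S z ≡ true → S' z ≡ true) → SimplePath S a b → SimplePath S' a b
  SimplePath-mono S⊆S' P = record { SimplePath P; inside = All.map S⊆S' (SimplePath.inside P) }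

  edgePath : ∀ {S a b} → S a ≡ true → S b ≡ true → Edge T a b → SimplePath S a b
  edgePath Sa Sb ab = record
    { interior = []
    ; unique   = (Edge⇒≢ T ab ∷ []) ∷ [] ∷ []
    ; inside   = Sa ∷ Sb ∷ []
    ; linked   = ab ∷ [-]
    }

  module _ {S : Fin n → Bool} where

    outside-≢ : ∀ {x vs} → S x ≡ false → All (λ z → S z ≡ true) vs → All (x ≢_) vs
    outside-≢ Sx = All.map (λ { Sz refl → contradiction (trans (sym Sz) Sx) λ () })

    prepend : ∀ {x a b} → S x ≡ false → Edge T x a → SimplePath S a b → SimplePath (insert x S) x b
    prepend {x} {a} Sx xa P = record
      { interior = a ∷ interior
      ; unique   = outside-≢ Sx inside ∷ unique
      ; inside   = insert-∋ S x ∷ All.map (insert-⊇ S x) inside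
      ; linked   = xa ∷ linked
      }
      where open SimplePath P

    append : ∀ {x a b} → S x ≡ false → Edge T b x → SimplePath S a b → SimplePath (insert x S) a x
    append {x} {a} {b} Sx bx P = record
      { interior = interior ++ [ b ]
      ; unique   = AllPairs.++⁺ unique ([] ∷ []) (All.map (λ x≢z → (x≢z ∘ sym) ∷ []) (outside-≢ Sx inside))
      ; inside   = All.++⁺ (All.map (insert-⊇ S x) inside) (insert-∋ S x ∷ [])
      ; linked   = Linked-snoc a interior linked bx
      }
      where open SimplePath P

    closeCycle : ∀ {x a b} → S x ≡ false → Edge T x a → Edge T x b →
                 (P : SimplePath S a b) → IsCycle T (x ∷ pathVertices a (SimplePath.interior P) b)
    closeCycle Sx xa xb P =
        s≤s (s≤s (length-++-≤ʳ _ {interior}))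
      , outside-≢ Sx inside ∷ unique
      , xa ∷ SimplePath.linked (append Sx (Edge-sym T xb) P)
      where open SimplePath P

    outsideNeighbour-unique : Acyclic T → ConnectedIn S → ∀ {x a b} → S x ≡ false →
                              S a ≡ true → Edge T x a → S b ≡ true → Edge T x b → a ≡ b
    outsideNeighbour-unique acyclic connected {a = a} {b} Sx Sa xa Sb xb with a ≟ b
    ... | yes a≡b = a≡b
    ... | no  a≢b = contradiction (closeCycle Sx xa xb (connected Sa Sb a≢b)) (acyclic _)

    ConnectedIn-insert : ConnectedIn S → ∀ {s x} → S s ≡ true → S x ≡ false → Edge T s x →
                         ConnectedIn (insert x S)
    ConnectedIn-insert connected {s} {x} Ss Sx sx {a} {b} a∈ b∈ a≢b with insert⁻ S x {a} a∈ | insert⁻ S x {b} b∈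
    ... | inj₁ Sa   | inj₁ Sb   = SimplePath-mono (insert-⊇ S x) (connected Sa Sb a≢b)
    ... | inj₁ Sa   | inj₂ refl = pathTo Sa
      where
      pathTo : ∀ {a} → S a ≡ true → SimplePath (insert x S) a x
      pathTo {a} Sa with a ≟ s
      ... | yes refl = edgePath (insert-⊇ S x Ss) (insert-∋ S x) sx
      ... | no  a≢s  = append Sx sx (connected Sa Ss a≢s)
    ... | inj₂ refl | inj₁ Sb   = pathFrom Sb
      where
      pathFrom : ∀ {b} → S b ≡ true → SimplePath (insert x S) x b
      pathFrom {b} Sb with s ≟ b
      ... | yes refl = edgePath (insert-∋ S x) (insert-⊇ S x Ss) (Edge-sym T sx)
      ... | no  s≢b  = prepend Sx (Edge-sym T sx) (connected Ss Sb s≢b)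
    ... | inj₂ refl | inj₂ refl = contradiction refl a≢b

  crossingEdge : ∀ {S : Fin n → Bool} {u v} → Walk T u v → S u ≡ true → S v ≡ false →
                 ∃ λ s → ∃ λ x → S s ≡ true × S x ≡ false × Edge T s x
  crossingEdge here Su Sv = contradiction (trans (sym Su) Sv) λ ()
  crossingEdge {S} (step {w = w} uw walk) Su Sv with S w in Sw
  ... | true  = crossingEdge walk Sw Sv
  ... | false = _ , w , Su , Sw , uw

  nbrsIn : (Fin n → Bool) → Fin n → ℕ
  nbrsIn S w = ∑[ v < n ] (𝟙 (S v) * 𝟙 (Adj T w v))

  arcsIn : (Fin n → Bool) → ℕ
  arcsIn S = ∑[ w < n ] (𝟙 (S w) * nbrsIn S w)

  module _ {S : Fin n → Bool} {x : Fin n} (Sx : S x ≡ false) where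

    nbrsIn-insert : ∀ w → nbrsIn (insert x S) w ≡ nbrsIn S w + 𝟙 (Adj T w x)
    nbrsIn-insert w = begin
      ∑[ v < n ] (𝟙 (insert x S v) * 𝟙 (Adj T w v))                                  ≡⟨ sum-cong-≗ split ⟩
      ∑[ v < n ] (𝟙 (S v) * 𝟙 (Adj T w v) + 𝟙 (does (v ≟ x)) * 𝟙 (Adj T w v))       ≡⟨ ∑-distrib-+ (λ v → 𝟙 (S v) * 𝟙 (Adj T w v)) _ ⟩
      nbrsIn S w + ∑[ v < n ] (𝟙 (does (v ≟ x)) * 𝟙 (Adj T w v))                      ≡⟨ cong (nbrsIn S w +_) (∑-𝟙≟-* x _) ⟩
      nbrsIn S w + 𝟙 (Adj T w x)                                                      ∎
      where
      open ≡-Reasoning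
      split : ∀ v → 𝟙 (insert x S v) * 𝟙 (Adj T w v) ≡ 𝟙 (S v) * 𝟙 (Adj T w v) + 𝟙 (does (v ≟ x)) * 𝟙 (Adj T w v)
      split v = trans (cong (_* 𝟙 (Adj T w v)) (𝟙-insert S x Sx v)) (*-distribʳ-+ _ (𝟙 (S v)) _)

    arcsIn-insert : arcsIn (insert x S) ≡ arcsIn S + 2 * nbrsIn S x
    arcsIn-insert = begin
      ∑[ w < n ] (𝟙 (insert x S w) * nbrsIn (insert x S) w)
        ≡⟨ sum-cong-≗ expand ⟩
      ∑[ w < n ] (𝟙 (S w) * nbrsIn S w + (𝟙 (S w) * 𝟙 (Adj T w x) + 𝟙 (does (w ≟ x)) * (nbrsIn S w + 𝟙 (Adj T w x))))
        ≡⟨ ∑-distrib-+ (λ w → 𝟙 (S w) * nbrsIn S w) _ ⟩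
      arcsIn S + ∑[ w < n ] (𝟙 (S w) * 𝟙 (Adj T w x) + 𝟙 (does (w ≟ x)) * (nbrsIn S w + 𝟙 (Adj T w x)))
        ≡⟨ cong (arcsIn S +_) (∑-distrib-+ (λ w → 𝟙 (S w) * 𝟙 (Adj T w x)) _) ⟩
      arcsIn S + (∑[ w < n ] (𝟙 (S w) * 𝟙 (Adj T w x)) + ∑[ w < n ] (𝟙 (does (w ≟ x)) * (nbrsIn S w + 𝟙 (Adj T w x))))
        ≡⟨ cong (arcsIn S +_) (cong₂ _+_ (sum-cong-≗ (λ w → cong (λ b → 𝟙 (S w) * 𝟙 b) (Graph.sym T w x))) (∑-𝟙≟-* x _)) ⟩
      arcsIn S + (nbrsIn S x + (nbrsIn S x + 𝟙 (Adj T x x)))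
        ≡⟨ cong (λ b → arcsIn S + (nbrsIn S x + (nbrsIn S x + 𝟙 b))) (irrefl T x) ⟩
      arcsIn S + 2 * nbrsIn S x
        ∎
      where
      open ≡-Reasoning
      expand : ∀ w → 𝟙 (insert x S w) * nbrsIn (insert x S) w ≡
                     𝟙 (S w) * nbrsIn S w + (𝟙 (S w) * 𝟙 (Adj T w x) + 𝟙 (does (w ≟ x)) * (nbrsIn S w + 𝟙 (Adj T w x)))
      expand w = begin
        𝟙 (insert x S w) * nbrsIn (insert x S) w                         ≡⟨ cong₂ _*_ (𝟙-insert S x Sx w) (nbrsIn-insert w) ⟩
        (s + d) * (N + a)                                                ≡⟨ *-distribʳ-+ (N + a) s d ⟩
        s * (N + a) + d * (N + a)                                        ≡⟨ cong (_+ d * (N + a)) (*-distribˡ-+ s N a) ⟩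
        s * N + s * a + d * (N + a)                                      ≡⟨ +-assoc (s * N) (s * a) _ ⟩
        s * N + (s * a + d * (N + a))                                    ∎
        where
        s d N a : ℕ
        s = 𝟙 (S w)
        d = 𝟙 (does (w ≟ x))
        N = nbrsIn S w
        a = 𝟙 (Adj T w x)

  arcsIn-full : ∀ {S} → (∀ z → S z ≡ true) → arcsIn S ≡ ∑[ w < n ] deg T w
  arcsIn-full {S} full = sum-cong-≗ (λ w → trans (cong₂ (λ b c → 𝟙 b * c) (full w) (nbrsIn-full w)) (*-identityˡ _))
    where
    nbrsIn-full : ∀ w → nbrsIn S w ≡ deg T w
    nbrsIn-full w = trans (sum-cong-≗ (λ v → trans (cong (λ b → 𝟙 b * _) (full v)) (*-identityˡ _))) (sym (count-allFin (Adj T w)))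

module SpanningSubtree {m} (T : Graph (suc m)) (connected : Connected T) (acyclic : Acyclic T) where

  record Subtree (k : ℕ) : Set where
    field
      S           : Fin (suc m) → Bool
      root∈       : S zero ≡ true
      size        : ∑[ z < suc m ] 𝟙 (S z) ≡ suc k
      arcs        : arcsIn T S ≡ 2 * k
      connectedIn : ConnectedIn T S

  singleton : Subtree 0
  singleton = record
    { S           = isRoot
    ; root∈       = refl
    ; size        = ∑-𝟙≟ {suc m} zero
    ; arcs        = trans (∑-𝟙≟-* zero (nbrsIn T isRoot)) (trans (∑-𝟙≟-* zero (𝟙 ∘ Adj T zero)) (cong 𝟙 (irrefl T zero)))
    ; connectedIn = λ {a} {b} a∈ b∈ a≢b → contradiction (trans (≟-true⇒≡ {a = a} a∈) (sym (≟-true⇒≡ {a = b} b∈))) a≢b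
    }
    where
    isRoot : Fin (suc m) → Bool
    isRoot z = does (z ≟ zero)

  addLeaf : ∀ {k} (t : Subtree k) {s x} → Subtree.S t s ≡ true → Subtree.S t x ≡ false → Edge T s x → Subtree (suc k)
  addLeaf {k} t {s} {x} Ss Sx sx = record
    { S           = insert x S
    ; root∈       = insert-⊇ S x root∈
    ; size        = trans (∑-𝟙-insert S x Sx) (cong suc size)
    ; arcs        = begin
        arcsIn T (insert x S)         ≡⟨ arcsIn-insert T {S} Sx ⟩
        arcsIn T S + 2 * nbrsIn T S x ≡⟨ cong₂ (λ a d → a + 2 * d) arcs oneNeighbour ⟩
        2 * k + 2 * 1                 ≡⟨ *-distribˡ-+ 2 k 1 ⟨
        2 * (k + 1)                   ≡⟨ cong (2 *_) (+-comm k 1) ⟩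
        2 * suc k                     ∎
    ; connectedIn = ConnectedIn-insert T connectedIn Ss Sx sx
    }
    where
    open Subtree t
    open ≡-Reasoning
    oneNeighbour : nbrsIn T S x ≡ 1
    oneNeighbour = trans (sum-cong-≗ (λ v → sym (𝟙-∧ (S v) (Adj T x v))))
      (∑-𝟙-unique (λ v → S v ∧ Adj T x v) (cong₂ _∧_ Ss (Edge-sym T sx)) λ v h →
        outsideNeighbour-unique T acyclic connectedIn Sx (∧-conicalˡ _ _ h) (∧-conicalʳ _ _ h) Ss (Edge-sym T sx))

  extend : ∀ {k} (t : Subtree k) → (∀ z → Subtree.S t z ≡ true) ⊎ Subtree (suc k)
  extend t with any? (λ z → Subtree.S t z ≟ᵇ false)
  ... | no  none    = inj₁ (λ z → ¬-not (none ∘ (z ,_)))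
  ... | yes (y , Sy) with crossingEdge T (connected zero y) (Subtree.root∈ t) Sy
  ...   | s , x , Ss , Sx , sx = inj₂ (addLeaf t Ss Sx sx)

  extendBelow : ∀ {k} → Subtree k → k < m → Subtree (suc k)
  extendBelow t k<m with extend t
  ... | inj₁ full = contradiction (suc-injective (trans (sym (Subtree.size t)) (∑-𝟙-all _ full))) (<⇒≢ k<m)
  ... | inj₂ t'   = t'

  grow : ∀ k → k ≤ m → Subtree k
  grow zero    _   = singleton
  grow (suc k) k<m = extendBelow (grow k (<⇒≤ k<m)) k<m

  ∑deg-spanning : Subtree m → ∑[ w < suc m ] deg T w ≡ 2 * m
  ∑deg-spanning t with extend t
  ... | inj₁ full = trans (sym (arcsIn-full T full)) (Subtree.arcs t)
  ... | inj₂ t'   = contradiction (subst (_≤ suc m) (Subtree.size t') (∑-𝟙≤n (Subtree.S t'))) 1+n≰n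

∑deg-tree : ∀ {m} (T : Graph (suc m)) → Connected T → Acyclic T → ∑[ w < suc m ] deg T w ≡ 2 * m
∑deg-tree {m} T connected acyclic = ∑deg-spanning (grow m ≤-refl)
  where open SpanningSubtree T connected acyclic

-- Imported only here: its prefix +_ would make the ℕ sections (m +_) above ambiguous.
open import Data.Integer using (+_; _-_)
open import Data.Integer.Properties using ([+m]-[+n]≡m⊖n; ⊖-≥)

m≡[m+n]-n : ∀ m n → + m ≡ + (m + n) - + n
m≡[m+n]-n m n = sym (trans ([+m]-[+n]≡m⊖n (m + n) n) (trans (⊖-≥ (m≤n+m n m)) (cong +_ (m+n∸n≡m m n))))

corollary1 : (n : ℕ) (T : Graph n) → IsTree T → (p q : ℕ) → 1 ≤ p → 1 ≤ q →
    + hom (K p q) T ≡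
      + sum (map (λ w → deg T w ^ p +ℕ deg T w ^ q) (allFin n)) - + (2 *ℕ (n ∸ 1))
corollary1 (suc m) T (_ , connected , acyclic) (suc p) (suc q) _ _ =
  trans (m≡[m+n]-n (hom (K (suc p) (suc q)) T) (2 * m)) (cong (λ t → + t - + (2 * m)) (sym ∑deg^≡hom+2m))
  where
  open Forest T acyclic
  ∑deg^≡hom+2m : ∑[ w ∈ allFin (suc m) ] (deg T w ^ suc p + deg T w ^ suc q) ≡ hom (K (suc p) (suc q)) T + 2 * m
  ∑deg^≡hom+2m = begin
    ∑[ w ∈ allFin (suc m) ] (deg T w ^ suc p + deg T w ^ suc q)   ≡⟨ ∑∈-allFin (suc m) _ ⟩
    ∑[ w < suc m ] (deg T w ^ suc p + deg T w ^ suc q)            ≡⟨ hom-K+∑deg p q ⟨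
    hom (K (suc p) (suc q)) T + ∑[ w < suc m ] deg T w            ≡⟨ cong (λ d → hom (K (suc p) (suc q)) T + d) (∑deg-tree T connected acyclic) ⟩
    hom (K (suc p) (suc q)) T + 2 * m                             ∎
    where open ≡-Reasoning
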